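{- For every $i\ge1$, the cost incurred by $\mathrm{ALG}_i$ to serve the requests of a (complete) phase is $2(c(i)+1)w_i$.
   Context: Generalized $k$-server on weighted uniform metrics: server $s_i$ lives in a uniform metric $M_i$ with all pairwise distances $w_i$; a request is $r=(r(1),\dots,r(k))$ with $r(i)\in M_i$ and is served if some $s_i$ is at $r(i)$; moving $s_i$ costs $w_i$. Set $c(i)=2^{2^{i+1}-3}$ and $R_i=2^{2^{i+2}}$. Standing assumptions: $w_1=1$; for $2\le i\le k$, $w_i$ is an integer multiple of $2(1+c(i-1))w_{i-1}$, and $m_i:=w_i/(2(1+c(i-1))w_{i-1})$; $|M_i|\ge c(i)$; and every request presented to $\mathrm{ALG}_i$ is not satisfied by the current positions of its servers $s_1,\dots,s_i$ (so it must move a server at every request). Algorithms $\mathrm{ALG}_i$ (using servers $s_1,\dots,s_i$) work in phases. $\mathrm{ALG}_1$: on each request move $s_1$ to the requested point of $M_1$; a phase consists of $2(c(1)+1)=6$ requests and is complete once it has served 6 requests. $\mathrm{ALG}_i$, $i\ge2$: a phase consists of $c(i)+1$ subphases. First move $s_i$ to an arbitrary point of $M_i$ and run $\mathrm{ALG}_{i-1}$ (started afresh) on the incoming requests until the cost incurred by $\mathrm{ALG}_{i-1}$ equals exactly $w_i$ (learning subphase). For $p\in M_i$ let $m(p)$ be the number of requests of the learning subphase with $r(i)=p$, and let $P$ be a set of $c(i)$ points with largest counts (ties broken arbitrarily). Then $c(i)$ times: move $s_i$ to a point of $P$ not yet visited in this phase, remove it from $P$, and run $\mathrm{ALG}_{i-1}$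 until its cost in this subphase equals $w_i$. A phase of $\mathrm{ALG}_i$, $i\ge2$, is complete if all its subphases are finished. -}

module Defs where

open import Data.Nat using (ℕ; zero; suc; _+_; _*_; _∸_; _^_; _≤_; _<_; _≡ᵇ_)
open import Data.Nat.Properties using (_≟_)
open import Data.Bool using (if_then_else_)
open import Data.List using (List; []; _∷_; _++_; map; length; filter)
open import Data.Nat.ListAction using (sum)
open import Data.List.Membership.Propositional using (_∈_; _∉_)
open import Data.List.Relation.Unary.All using (All)
open import Data.List.Relation.Unary.Unique.Propositional using (Unique)
open import Data.Product using (_×_; _,_; proj₁; proj₂)
open import Relation.Binary.PropositionalEquality using (_≡_; _≢_)

c : ℕ → ℕ
c i = 2 ^ ((2 ^ (i + 1)) ∸ 3)

-- Points of the uniform metric M_j are the naturals 0 .. size j - 1.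
-- A configuration gives the position of server s_j for every index j
-- (only j = 1 .. k are meaningful); a request r gives r(j) ∈ M_j.
Config : Set
Config = ℕ → ℕ

Req : Set
Req = ℕ → ℕ

upd : Config → ℕ → ℕ → Config
upd σ i p j = if j ≡ᵇ i then p else σ j

Unsat : ℕ → Config → Req → Set
Unsat i σ r = ∀ j → 1 ≤ j → j ≤ i → σ j ≢ r j

-- An event of an execution: (configuration when the request arrives,
-- the request, the cost the algorithm incurs to serve it).
Ev : Set
Ev = Config × Req × ℕ

evConf : Ev → Config
evConf = proj₁

evReq : Ev → Req
evReq e = proj₁ (proj₂ e)

evCost : Ev → ℕ
evCost e = proj₂ (proj₂ e)

costs : List Ev → List ℕ
costs = map evCost

total : List Ev → ℕ
total t = sum (costs t)

FirstHit : ℕ → List ℕ → Set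
FirstHit w cs = (sum cs ≡ w) × (∀ xs ys → cs ≡ xs ++ ys → ys ≢ [] → sum xs ≢ w)

NeverHit : ℕ → List ℕ → Set
NeverHit w cs = ∀ xs ys → cs ≡ xs ++ ys → sum xs ≢ w

-- the (lazy) move of s_i at the beginning of a subphase is performed when the
-- first request of the subphase arrives: that request arrives at the old
-- configuration σ and its cost includes the move cost mv.
lazy : Config → ℕ → List Ev → List Ev
lazy σ mv [] = []
lazy σ mv ((_ , r , x) ∷ t) = (σ , r , mv + x) ∷ t

module ALG (w : ℕ → ℕ) (size : ℕ → ℕ) where

  moveCost : ℕ → Config → Config → ℕ
  moveCost zero σ τ = 0
  moveCost (suc i) σ τ =
    moveCost i σ τ + (if σ (suc i) ≡ᵇ τ (suc i) then 0 else w (suc i))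

  cnt : ℕ → List Ev → ℕ → ℕ
  cnt i t p = length (filter (λ e → evReq e i ≟ p) t)

  data Steps1 : Config → List Ev → Config → Set where
    done : ∀ {σ} → Steps1 σ [] σ
    step : ∀ {σ r t τ} → Steps1 (upd σ 1 (r 1)) t τ →
           Steps1 σ ((σ , r , moveCost 1 σ (upd σ 1 (r 1))) ∷ t) τ

  mutual
    -- Run i σ t τ : ALG_i, started afresh in configuration σ, serves the
    -- requests of trace t (any number of them, possibly stopping in the
    -- middle of a phase) and ends in configuration τ.
    data Run : ℕ → Config → List Ev → Config → Set where
      stop : ∀ {i σ t τ} → PartialPhase i σ t τ → Run i σ t τ
      next : ∀ {i σ τ ρ t₁ t₂} → Phase i σ t₁ τ → Run i τ t₂ ρ → Run i σ (t₁ ++ t₂) ρ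

    data Phase : ℕ → Config → List Ev → Config → Set where
      phase1 : ∀ {σ t τ} → Steps1 σ t τ → length t ≡ 2 * (c 1 + 1) → Phase 1 σ t τ
      phaseS : ∀ {n σ p₀ tL τL P t τ} →
        let i = suc (suc n) in
        p₀ < size i → p₀ ≢ σ i →
        SubC (suc n) σ p₀ tL τL →
        length P ≡ c i → Unique P → All (_< size i) P →
        (∀ p q → p ∈ P → q < size i → q ∉ P → cnt i tL q ≤ cnt i tL p) →
        Subs (suc n) (c i) (p₀ ∷ []) P τL t τ →
        Phase i σ (tL ++ t) τ

    -- a proper prefix (possibly empty) of a phase of ALG_i
    data PartialPhase : ℕ → Config → List Ev → Config → Set where
      part1 : ∀ {σ t τ} → Steps1 σ t τ → length t < 2 * (c 1 + 1) → PartialPhase 1 σ t τ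
      partL : ∀ {n σ p₀ t τ} →
        let i = suc (suc n) in
        p₀ < size i → p₀ ≢ σ i →
        SubP (suc n) σ p₀ t τ →
        PartialPhase i σ t τ
      partS : ∀ {n σ p₀ tL τL P t τ} →
        let i = suc (suc n) in
        p₀ < size i → p₀ ≢ σ i →
        SubC (suc n) σ p₀ tL τL →
        length P ≡ c i → Unique P → All (_< size i) P →
        (∀ p q → p ∈ P → q < size i → q ∉ P → cnt i tL q ≤ cnt i tL p) →
        PSubs (suc n) (c i) (p₀ ∷ []) P τL t τ →
        PartialPhase i σ (tL ++ t) τ

    -- a complete subphase of ALG_{n+1} (level i = n+1 below uses ALG_n):
    -- move s_{n+1} to p, run ALG_n afresh until its cost equals w_{n+1}
    data SubC : ℕ → Config → ℕ → List Ev → Config → Set where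
      subC : ∀ {n σ p t τ} →
        Run n (upd σ (suc n) p) t τ →
        FirstHit (w (suc n)) (costs t) →
        SubC n σ p (lazy σ (moveCost (suc n) σ (upd σ (suc n) p)) t) τ

    data SubP : ℕ → Config → ℕ → List Ev → Config → Set where
      subP : ∀ {n σ p t τ} →
        Run n (upd σ (suc n) p) t τ →
        NeverHit (w (suc n)) (costs t) →
        SubP n σ p (lazy σ (moveCost (suc n) σ (upd σ (suc n) p)) t) τ

    -- m remaining complete non-learning subphases, visited points vis
    data Subs : ℕ → ℕ → List ℕ → List ℕ → Config → List Ev → Config → Set where
      none : ∀ {n vis P σ} → Subs n 0 vis P σ [] σ
      more : ∀ {n m vis P σ p t₁ τ t₂ ρ} →
        p ∈ P → p ∉ vis → SubC n σ p t₁ τ →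
        Subs n m (p ∷ vis) P τ t₂ ρ →
        Subs n (suc m) vis P σ (t₁ ++ t₂) ρ

    data PSubs : ℕ → ℕ → List ℕ → List ℕ → Config → List Ev → Config → Set where
      now  : ∀ {n m vis P σ p t τ} →
        p ∈ P → p ∉ vis → SubP n σ p t τ →
        PSubs n (suc m) vis P σ t τ
      more : ∀ {n m vis P σ p t₁ τ t₂ ρ} →
        p ∈ P → p ∉ vis → SubC n σ p t₁ τ →
        PSubs n m (p ∷ vis) P τ t₂ ρ →
        PSubs n (suc m) vis P σ (t₁ ++ t₂) ρ

module Submission where

-- A phase of ALG_1 consists of 2(c(1)+1) requests, none satisfied by s_1, so
-- each costs exactly w_1.  A phase of ALG_i (i ≥ 2) consists of c(i)+1
-- subphases; each one moves s_i (cost w_i) and then runs ALG_{i-1} until its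
-- cost is exactly w_i, so every subphase costs 2w_i.  The only subtle point
-- is that the move of s_i really costs w_i: the learning subphase starts at a
-- point different from the current one, and each later subphase moves to a
-- point not yet visited in the phase, while s_i sits on the most recently
-- visited point because ALG_{i-1} never touches servers s_j with j ≥ i.

open import Defs
open import Data.Bool using (true; false; T; if_then_else_)
open import Data.Empty using (⊥-elim)
open import Data.List using ([]; _∷_; _++_; length)
open import Data.List.Properties using (map-++)
open import Data.List.Membership.Propositional using (_∈_)
open import Data.List.Relation.Unary.All using (All; []; _∷_)
open import Data.List.Relation.Unary.Any using (here)
open import Data.Nat using (ℕ; zero; suc; _+_; _*_; _∸_; _≤_; _<_; _≡ᵇ_; s≤s; z≤n)
open import Data.Nat.Properties using (≡ᵇ⇒≡; ≡⇒≡ᵇ; <⇒≢; <-trans; n<1+n; ≤-refl; +-assoc)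
open import Data.Nat.ListAction.Properties using (sum-++)
open import Data.Nat.Tactic.RingSolver using (solve-∀)
open import Data.Product using (_×_; _,_; ∃-syntax)
open import Data.Unit using (tt)
open import Relation.Binary.PropositionalEquality
  using (_≡_; _≢_; refl; sym; trans; cong; cong₂; subst; module ≡-Reasoning)

≡ᵇ-refl : ∀ m → (m ≡ᵇ m) ≡ true
≡ᵇ-refl m with m ≡ᵇ m | ≡⇒≡ᵇ m m refl
... | true | _ = refl

≢⇒≡ᵇ-false : ∀ {m n} → m ≢ n → (m ≡ᵇ n) ≡ false
≢⇒≡ᵇ-false {m} {n} m≢n with m ≡ᵇ n in eq
... | false = refl
... | true  = ⊥-elim (m≢n (≡ᵇ⇒≡ m n (subst T (sym eq) tt)))

upd-same : ∀ (σ : Config) i p → upd σ i p i ≡ p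
upd-same σ i p rewrite ≡ᵇ-refl i = refl

upd-other : ∀ (σ : Config) i p j → j ≢ i → upd σ i p j ≡ σ j
upd-other σ i p j j≢i rewrite ≢⇒≡ᵇ-false j≢i = refl

>⇒≢ : ∀ {i j} → i < j → j ≢ i
>⇒≢ i<j j≡i = <⇒≢ i<j (sym j≡i)

uniformCost : ∀ (a b W : ℕ) → a ≢ b → (if a ≡ᵇ b then 0 else W) ≡ W
uniformCost a b W a≢b rewrite ≢⇒≡ᵇ-false a≢b = refl

total-++ : ∀ t₁ t₂ → total (t₁ ++ t₂) ≡ total t₁ + total t₂
total-++ t₁ t₂ rewrite map-++ evCost t₁ t₂ = sum-++ (costs t₁) (costs t₂)

-- A subphase whose lazy initial move and whose inner run both cost W costs
-- 2W (if the inner run is empty then W = 0, so the claim still holds).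
total-lazy : ∀ σ t W → total t ≡ W → total (lazy σ W t) ≡ W + W
total-lazy σ [] W total≡W rewrite sym total≡W = refl
total-lazy σ ((_ , _ , x) ∷ t) W total≡W = begin
  (W + x) + total t  ≡⟨ +-assoc W x (total t) ⟩
  W + (x + total t)  ≡⟨ cong (W +_) total≡W ⟩
  W + W              ∎
  where open ≡-Reasoning

subphasesTotal : ∀ c W → (W + W) + c * (W + W) ≡ 2 * (c + 1) * W
subphasesTotal = solve-∀

module Execution (w size : ℕ → ℕ) where
  open ALG w size

  moveCost-below : ∀ m (σ : Config) i p → m < i → moveCost m σ (upd σ i p) ≡ 0
  moveCost-below zero    σ i p m<i = refl
  moveCost-below (suc m) σ i p m<i
    rewrite moveCost-below m σ i p (<-trans (n<1+n m) m<i)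
          | ≢⇒≡ᵇ-false (<⇒≢ m<i) | ≡ᵇ-refl (σ (suc m)) = refl

  moveCost-single : ∀ n (σ : Config) p → p ≢ σ (suc n) →
                    moveCost (suc n) σ (upd σ (suc n) p) ≡ w (suc n)
  moveCost-single n σ p p≢σ
    rewrite moveCost-below n σ (suc n) p ≤-refl | upd-same σ (suc n) p =
    uniformCost (σ (suc n)) p (w (suc n)) (λ e → p≢σ (sym e))

  steps1-local : ∀ {σ t τ} → Steps1 σ t τ → ∀ j → 1 < j → τ j ≡ σ j
  steps1-local done j _ = refl
  steps1-local {σ} (step {r = r} s) j 1<j =
    trans (steps1-local s j 1<j) (upd-other σ 1 (r 1) j (>⇒≢ 1<j))

  mutual
    run-local : ∀ {n σ t τ} → Run n σ t τ → ∀ j → n < j → τ j ≡ σ j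
    run-local (stop pp)   j n<j = partial-local pp j n<j
    run-local (next ph r) j n<j = trans (run-local r j n<j) (phase-local ph j n<j)

    phase-local : ∀ {n σ t τ} → Phase n σ t τ → ∀ j → n < j → τ j ≡ σ j
    phase-local (phase1 s _) j n<j = steps1-local s j n<j
    phase-local (phaseS _ _ sc _ _ _ _ ss) j n<j =
      trans (subs-local ss j n<j) (subC-local sc j n<j)

    partial-local : ∀ {n σ t τ} → PartialPhase n σ t τ → ∀ j → n < j → τ j ≡ σ j
    partial-local (part1 s _)  j n<j = steps1-local s j n<j
    partial-local (partL _ _ sp) j n<j = subP-local sp j n<j
    partial-local (partS _ _ sc _ _ _ _ ss) j n<j =
      trans (psubs-local ss j n<j) (subC-local sc j n<j)

    subC-local : ∀ {n σ p t τ} → SubC n σ p t τ → ∀ j → suc n < j → τ j ≡ σ j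
    subC-local {n} {σ} {p} (subC r _) j n+1<j =
      trans (run-local r j (<-trans (n<1+n n) n+1<j)) (upd-other σ (suc n) p j (>⇒≢ n+1<j))

    subP-local : ∀ {n σ p t τ} → SubP n σ p t τ → ∀ j → suc n < j → τ j ≡ σ j
    subP-local {n} {σ} {p} (subP r _) j n+1<j =
      trans (run-local r j (<-trans (n<1+n n) n+1<j)) (upd-other σ (suc n) p j (>⇒≢ n+1<j))

    subs-local : ∀ {n m vis P σ t τ} → Subs n m vis P σ t τ → ∀ j → suc n < j → τ j ≡ σ j
    subs-local none j _ = refl
    subs-local (more _ _ sc ss) j n+1<j = trans (subs-local ss j n+1<j) (subC-local sc j n+1<j)

    psubs-local : ∀ {n m vis P σ t τ} → PSubs n m vis P σ t τ → ∀ j → suc n < j → τ j ≡ σ j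
    psubs-local (now _ _ sp) j n+1<j = subP-local sp j n+1<j
    psubs-local (more _ _ sc ss) j n+1<j = trans (psubs-local ss j n+1<j) (subC-local sc j n+1<j)

  subC-target : ∀ {n σ p t τ} → SubC n σ p t τ → τ (suc n) ≡ p
  subC-target {n} {σ} {p} (subC r _) =
    trans (run-local r (suc n) ≤-refl) (upd-same σ (suc n) p)

  subC-cost : ∀ {n σ p t τ} → SubC n σ p t τ → p ≢ σ (suc n) →
              total t ≡ w (suc n) + w (suc n)
  subC-cost {n} {σ} {p} (subC {t = t} _ (total≡w , _)) p≢σ
    rewrite moveCost-single n σ p p≢σ = total-lazy σ t (w (suc n)) total≡w

  -- m complete non-learning subphases cost m·2w_{n+1}, provided s_{n+1}
  -- starts on a visited point: each subphase then goes to an unvisited,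
  -- hence different, point and leaves s_{n+1} on a visited one.
  subs-cost : ∀ {n m vis P σ t τ} → Subs n m vis P σ t τ → σ (suc n) ∈ vis →
              total t ≡ m * (w (suc n) + w (suc n))
  subs-cost none _ = refl
  subs-cost (more {vis = vis} {t₁ = t₁} {t₂ = t₂} _ p∉vis sc ss) σ∈vis =
    trans (total-++ t₁ t₂)
      (cong₂ _+_ (subC-cost sc (λ p≡σ → p∉vis (subst (_∈ vis) (sym p≡σ) σ∈vis)))
                 (subs-cost ss (here (subC-target sc))))

  steps1-cost : ∀ {σ t τ} → Steps1 σ t τ → All (λ e → Unsat 1 (evConf e) (evReq e)) t →
                total t ≡ length t * w 1
  steps1-cost done [] = refl
  steps1-cost {σ} (step {r = r} s) (unsat ∷ unsats) =
    cong₂ _+_ (uniformCost (σ 1) (r 1) (w 1) (unsat 1 (s≤s z≤n) (s≤s z≤n)))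
              (steps1-cost s unsats)

  phase-cost : ∀ {i σ t τ} → Phase i σ t τ → w 1 ≡ 1 →
               All (λ e → Unsat i (evConf e) (evReq e)) t → total t ≡ 2 * (c i + 1) * w i
  phase-cost (phase1 s length≡) w₁≡1 unsats
    rewrite steps1-cost s unsats | length≡ | w₁≡1 = refl
  phase-cost (phaseS {n = n} {tL = tL} {t = t} _ p₀≢σ learning _ _ _ _ rest) _ _ =
    trans (total-++ tL t)
      (trans (cong₂ _+_ (subC-cost learning p₀≢σ) (subs-cost rest (here (subC-target learning))))
             (subphasesTotal (c (suc (suc n))) (w (suc (suc n)))))

corollary1 : (k : ℕ) (w size : ℕ → ℕ) →
    w 1 ≡ 1 →
    (∀ i → 2 ≤ i → i ≤ k → ∃[ m ] (1 ≤ m × w i ≡ m * (2 * (1 + c (i ∸ 1)) * w (i ∸ 1)))) →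
    (∀ i → 1 ≤ i → i ≤ k → c i ≤ size i) →
    ∀ i → 1 ≤ i → i ≤ k →
    ∀ σ t τ → ALG.Phase w size i σ t τ →
    (∀ j → 1 ≤ j → j ≤ k → σ j < size j) →
    All (λ e → ∀ j → 1 ≤ j → j ≤ k → evReq e j < size j) t →
    All (λ e → Unsat i (evConf e) (evReq e)) t →
    total t ≡ 2 * (c i + 1) * w i
corollary1 k w size w₁≡1 _ _ i _ _ σ t τ phase _ _ unsats =
  Execution.phase-cost w size phase w₁≡1 unsats
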